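{- For all $n\ge3$, $d_n(231)<F_n$.
   Context: $d_n(231)$ is the number of permutations $\pi=\pi_1\cdots\pi_n$ of $\{1,\dots,n\}$ with no fixed points ($\pi_i\ne i$ for all $i$) that avoid $231$ (no indices $i<j<k$ with $\pi_k<\pi_i<\pi_j$). The Fine numbers are $F_n=\sum_{1\le k\le n/2}\left[\binom{2n-2k-1}{n-1}-\binom{2n-2k-1}{n}\right]$ for $n\ge1$, so $F_1=0,F_2=1,F_3=2,F_4=6,F_5=18,\dots$. -}

module Defs where

open import Data.Nat using (ℕ; zero; suc; _+_; _∸_; _<_; _≤_; _<ᵇ_; _≡ᵇ_; _≤ᵇ_; _/_)
open import Data.Nat.Combinatorics using (_C_)
open import Data.Bool using (Bool; true; false; _∧_; _∨_; not)
open import Data.List using (List; []; _∷_; length; filter; map; concatMap; applyUpTo)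
open import Data.Bool.ListAction using (all; any)
open import Data.Product using (_×_; _,_)
open import Relation.Nullary.Decidable using (Dec; yes; no)
open import Data.Bool using (T; T?)

words : ℕ → ℕ → List (List ℕ)
words m zero = [] ∷ []
words m (suc k) = concatMap (λ a → map (a ∷_) (words m k)) (applyUpTo suc m)

isPerm : ℕ → List ℕ → Bool
isPerm n w = all (λ v → any (λ x → x ≡ᵇ v) w) (applyUpTo suc n)

perms : ℕ → List (List ℕ)
perms n = filter (λ w → T? (isPerm n w)) (words n n)

noFixAux : ℕ → List ℕ → Bool
noFixAux i [] = true
noFixAux i (x ∷ xs) = not (x ≡ᵇ i) ∧ noFixAux (suc i) xs

noFix : List ℕ → Bool
noFix = noFixAux 1

-- contains 231: indices i<j<k with π_k < π_i < π_j
-- has21 a xs : exists j<k in xs with xs_k < a < xs_j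
has21 : ℕ → List ℕ → Bool
has21 a [] = false
has21 a (y ∷ ys) = ((a <ᵇ y) ∧ any (λ z → z <ᵇ a) ys) ∨ has21 a ys

contains231 : List ℕ → Bool
contains231 [] = false
contains231 (x ∷ xs) = has21 x xs ∨ contains231 xs

avoids231 : List ℕ → Bool
avoids231 w = not (contains231 w)

d231 : ℕ → ℕ
d231 n = length (filter (λ w → T? (noFix w ∧ avoids231 w)) (perms n))

-- Fine numbers: F_n = Σ_{1 ≤ k ≤ n/2} [C(2n-2k-1, n-1) - C(2n-2k-1, n)]
-- (each summand is a nonnegative ballot number since 2n-2k-1 ≥ ... ; truncated ∸ is exact here)
fineSum : ℕ → ℕ → ℕ
fineSum n zero = 0
fineSum n (suc k) = fineSum n k + (((2 * n ∸ 2 * suc k ∸ 1) C (n ∸ 1)) ∸ ((2 * n ∸ 2 * suc k ∸ 1) C n))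
  where open import Data.Nat using (_*_)

fine : ℕ → ℕ
fine n = fineSum n (n / 2)

-- A 231-avoiding arrangement of an interval splits at its maximum M as α M γ with every entry
-- of α below every entry of γ (otherwise x M y would be a 231), so α and γ are 231-avoiding
-- arrangements of the lower and upper subinterval and there are at most Catalan-many. For a
-- 231-avoiding derangement of [n], the entry n sits at a position a + 1 ≤ n − 1, α is a
-- 231-avoiding derangement of [a], and γ is a 231-avoiding arrangement of (a, n − 1] that does
-- not start with a + 2; hence d_n ≤ Σ_a d_a C_{n−1−a}. Writing the binomial differences in F_n
-- as ballot numbers shows that F_n (with F₀ = 1) satisfies exactly F_n = Σ_a F_a C_{n−1−a}, and
-- for n ≥ 3 the term a = 0 is strict since γ = 2 1 3 ⋯ (n − 1) is excluded.
module Submission where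

open import Defs
open import Data.Nat using (ℕ; zero; suc; _+_; _*_; _∸_; _≤_; _<_; z≤n; s≤s; _/_; _<ᵇ_; _≡ᵇ_; _≟_)
open import Data.Nat.Properties
open import Data.Nat.ListAction using (sum)
open import Data.Nat.Combinatorics using (_C_; nCk+nC[k+1]≡[n+1]C[k+1]; nCn≡1; nCk≡nC[n∸k]; k>n⇒nCk≡0)
open import Data.Nat.DivMod using (m/n≡1+[m∸n]/n; m/n*n≤m)
open import Data.Nat.Tactic.RingSolver using (solve-∀)
open import Algebra.Properties.CommutativeSemigroup +-commutativeSemigroup using (interchange; xy∙z≈xz∙y)
open import Data.Bool using (Bool; true; T; not; _∧_; _∨_; T?)
open import Data.Bool.Properties using (T-∨; T-∧; T-not-≡)
open import Data.Bool.ListAction using (any)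
open import Data.List using (List; []; _∷_; _++_; length; map; concatMap; applyUpTo; upTo; filter; cartesianProductWith)
open import Data.List.Properties using (length-++; length-map; length-applyUpTo; length-filter; filter-notAll; map-upTo; applyUpTo-∷ʳ; ++-assoc; ∷-injective)
open import Data.List.Relation.Unary.All using (All; []; _∷_; lookup; tabulate)
open import Data.List.Relation.Unary.All.Properties using (¬Any⇒All¬; all⁺) renaming (++⁻ˡ to All-++⁻ˡ; ++⁻ʳ to All-++⁻ʳ; ++⁺ to All-++⁺)
open import Data.List.Relation.Unary.Any using (here; there; any?) renaming (map to Any-map)
open import Data.List.Relation.Unary.Any.Properties using (any⁺; any⁻) renaming (++⁺ˡ to Any-++⁺ˡ)
open import Data.List.Relation.Unary.AllPairs using ([]; _∷_)
open import Data.List.Relation.Unary.Unique.Propositional using (Unique)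
open import Data.List.Relation.Unary.Unique.Propositional.Properties using (applyUpTo⁺₁; cartesianProductWith⁺; filter⁺)
open import Data.List.Relation.Binary.Subset.Propositional using (_⊆_)
open import Data.List.Relation.Binary.Disjoint.Propositional using (Disjoint)
open import Data.List.Membership.Propositional using (_∈_; _∉_; lose)
open import Data.List.Membership.Propositional.Properties using (∈-∃++; ∈-++⁻; ∈-++⁺ˡ; ∈-++⁺ʳ; ∈-applyUpTo⁺; ∈-applyUpTo⁻; ∈-upTo⁺; ∈-concatMap⁺; ∈-cartesianProductWith⁺; ∈-cartesianProductWith⁻; ∈-filter⁺; ∈-filter⁻)
open import Data.Product using (_×_; _,_; proj₁; proj₂)
open import Data.Sum using (inj₁; inj₂) renaming (map to ⊎-map)
open import Data.Empty using (⊥-elim)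
open import Function using (_∘_; Equivalence)
open import Relation.Nullary using (¬_; yes; no)
open import Relation.Binary using (tri<; tri≈; tri>)
open import Relation.Binary.Definitions using (DecidableEquality)
open import Relation.Binary.PropositionalEquality
open import Level using (Level)

open Equivalence using (to; from)

module FineNumbers where

  open ≡-Reasoning

  -- ballot h d counts lattice paths with d up-steps from height h down to 0 that never go
  -- below 0; ballot 0 d is the Catalan number.
  ballot : ℕ → ℕ → ℕ
  ballot h zero = 1
  ballot zero (suc d) = ballot 1 d
  ballot (suc h) (suc d) = ballot h (suc d) + ballot (2 + h) d

  catalan : ℕ → ℕ
  catalan = ballot 0

  convolve : (ℕ → ℕ) → (ℕ → ℕ) → ℕ → ℕ
  convolve f g n = sum (applyUpTo (λ i → f i * g (n ∸ i)) (suc n))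

  convolve-sucʳ : ∀ n f g → convolve f g (suc n) ≡ convolve f (g ∘ suc) n + f (suc n) * g 0
  convolve-sucʳ zero f g = begin
    f 0 * g 1 + (f 1 * g 0 + 0) ≡⟨ cong (f 0 * g 1 +_) (+-identityʳ _) ⟩
    f 0 * g 1 + f 1 * g 0       ≡⟨ cong (_+ f 1 * g 0) (+-identityʳ _) ⟨
    (f 0 * g 1 + 0) + f 1 * g 0 ∎
  convolve-sucʳ (suc n) f g = begin
    f 0 * g (2 + n) + convolve (f ∘ suc) g (suc n)
      ≡⟨ cong (f 0 * g (2 + n) +_) (convolve-sucʳ n (f ∘ suc) g) ⟩
    f 0 * g (2 + n) + (convolve (f ∘ suc) (g ∘ suc) n + f (2 + n) * g 0)
      ≡⟨ +-assoc (f 0 * g (2 + n)) _ _ ⟨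
    convolve f (g ∘ suc) (suc n) + f (2 + n) * g 0 ∎

  convolve-+ʳ : ∀ n f g h → convolve f (λ i → g i + h i) n ≡ convolve f g n + convolve f h n
  convolve-+ʳ zero f g h = begin
    f 0 * (g 0 + h 0) + 0 ≡⟨ cong (_+ 0) (*-distribˡ-+ (f 0) (g 0) (h 0)) ⟩
    f 0 * g 0 + f 0 * h 0 + 0 ≡⟨ interchange (f 0 * g 0) (f 0 * h 0) 0 0 ⟩
    (f 0 * g 0 + 0) + (f 0 * h 0 + 0) ∎
  convolve-+ʳ (suc n) f g h = begin
    f 0 * (g (suc n) + h (suc n)) + convolve (f ∘ suc) (λ i → g i + h i) n
      ≡⟨ cong₂ _+_ (*-distribˡ-+ (f 0) (g (suc n)) (h (suc n))) (convolve-+ʳ n (f ∘ suc) g h) ⟩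
    (f 0 * g (suc n) + f 0 * h (suc n)) + (convolve (f ∘ suc) g n + convolve (f ∘ suc) h n)
      ≡⟨ interchange (f 0 * g (suc n)) _ _ _ ⟩
    convolve f g (suc n) + convolve f h (suc n) ∎

  convolve-+ˡ : ∀ n f g h → convolve (λ i → f i + g i) h n ≡ convolve f h n + convolve g h n
  convolve-+ˡ zero f g h = begin
    (f 0 + g 0) * h 0 + 0 ≡⟨ cong (_+ 0) (*-distribʳ-+ (h 0) (f 0) (g 0)) ⟩
    f 0 * h 0 + g 0 * h 0 + 0 ≡⟨ interchange (f 0 * h 0) (g 0 * h 0) 0 0 ⟩
    (f 0 * h 0 + 0) + (g 0 * h 0 + 0) ∎
  convolve-+ˡ (suc n) f g h = begin
    (f 0 + g 0) * h (suc n) + convolve (λ i → f (suc i) + g (suc i)) h n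
      ≡⟨ cong₂ _+_ (*-distribʳ-+ (h (suc n)) (f 0) (g 0)) (convolve-+ˡ n (f ∘ suc) (g ∘ suc) h) ⟩
    (f 0 * h (suc n) + g 0 * h (suc n)) + (convolve (f ∘ suc) h n + convolve (g ∘ suc) h n)
      ≡⟨ interchange (f 0 * h (suc n)) _ _ _ ⟩
    convolve f h (suc n) + convolve g h (suc n) ∎

  -- Decomposing a path at its first visit to height h.
  ballot-suc≡convolve : ∀ d h → ballot (suc h) d ≡ convolve catalan (ballot h) d
  ballot-suc≡convolve zero h = refl
  ballot-suc≡convolve (suc d) zero = begin
    catalan (suc d) + ballot 2 d ≡⟨ +-comm (catalan (suc d)) _ ⟩
    ballot 2 d + catalan (suc d) ≡⟨ cong₂ _+_ (ballot-suc≡convolve d 1) (sym (*-identityʳ _)) ⟩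
    convolve catalan (ballot 1) d + catalan (suc d) * 1 ≡⟨ convolve-sucʳ d catalan catalan ⟨
    convolve catalan catalan (suc d) ∎
  ballot-suc≡convolve (suc d) (suc h) = begin
    ballot (suc h) (suc d) + ballot (3 + h) d
      ≡⟨ cong₂ _+_ (ballot-suc≡convolve (suc d) h) (ballot-suc≡convolve d (2 + h)) ⟩
    convolve catalan (ballot h) (suc d) + convolve catalan (ballot (2 + h)) d
      ≡⟨ cong (_+ convolve catalan (ballot (2 + h)) d) (convolve-sucʳ d catalan (ballot h)) ⟩
    (convolve catalan (ballot h ∘ suc) d + catalan (suc d) * 1) + convolve catalan (ballot (2 + h)) d
      ≡⟨ xy∙z≈xz∙y (convolve catalan (ballot h ∘ suc) d) _ _ ⟩
    (convolve catalan (ballot h ∘ suc) d + convolve catalan (ballot (2 + h)) d) + catalan (suc d) * 1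
      ≡⟨ cong (_+ catalan (suc d) * 1) (convolve-+ʳ d catalan (ballot h ∘ suc) (ballot (2 + h))) ⟨
    convolve catalan (ballot (suc h) ∘ suc) d + catalan (suc d) * 1
      ≡⟨ convolve-sucʳ d catalan (ballot (suc h)) ⟨
    convolve catalan (ballot (suc h)) (suc d) ∎

  ballot-2+≡convolve : ∀ h d → ballot (2 + h) d ≡ convolve (ballot h) (ballot 1) d
  ballot-2+≡convolve zero d = ballot-suc≡convolve d 1
  ballot-2+≡convolve (suc h) zero = refl
  ballot-2+≡convolve (suc h) (suc d) = begin
    ballot (2 + h) (suc d) + ballot (4 + h) d
      ≡⟨ cong₂ _+_ (ballot-2+≡convolve h (suc d)) (ballot-2+≡convolve (2 + h) d) ⟩
    (1 * ballot 1 (suc d) + convolve (ballot h ∘ suc) (ballot 1) d) + convolve (ballot (2 + h)) (ballot 1) d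
      ≡⟨ +-assoc (1 * ballot 1 (suc d)) _ _ ⟩
    1 * ballot 1 (suc d) + (convolve (ballot h ∘ suc) (ballot 1) d + convolve (ballot (2 + h)) (ballot 1) d)
      ≡⟨ cong (1 * ballot 1 (suc d) +_) (convolve-+ˡ d (ballot h ∘ suc) (ballot (2 + h)) (ballot 1)) ⟨
    convolve (ballot (suc h)) (ballot 1) (suc d) ∎

  ballotSeries : ℕ → ℕ → ℕ
  ballotSeries h zero = ballot h 0
  ballotSeries h (suc zero) = ballot h 1
  ballotSeries h (suc (suc d)) = ballot h (2 + d) + ballotSeries (2 + h) d

  ballotSeries-2+≡convolve : ∀ h d → ballotSeries (2 + h) d ≡ convolve (ballotSeries h) (ballot 1) d
  ballotSeries-2+≡convolve h zero = refl
  ballotSeries-2+≡convolve h (suc zero) = ballot-2+≡convolve h 1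
  ballotSeries-2+≡convolve h (suc (suc d)) = begin
    ballot (2 + h) (2 + d) + ballotSeries (4 + h) d
      ≡⟨ cong₂ _+_ (ballot-2+≡convolve h (2 + d)) (ballotSeries-2+≡convolve (2 + h) d) ⟩
    (a + (b + X)) + Y ≡⟨ +-assoc a (b + X) Y ⟩
    a + ((b + X) + Y) ≡⟨ cong (a +_) (+-assoc b X Y) ⟩
    a + (b + (X + Y))
      ≡⟨ cong (λ z → a + (b + z)) (convolve-+ˡ d (ballot h ∘ suc ∘ suc) (ballotSeries (2 + h)) (ballot 1)) ⟨
    convolve (ballotSeries h) (ballot 1) (2 + d) ∎
    where
    a = ballot h 0 * ballot 1 (2 + d)
    b = ballot h 1 * ballot 1 (suc d)
    X = convolve (ballot h ∘ suc ∘ suc) (ballot 1) d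
    Y = convolve (ballotSeries (2 + h)) (ballot 1) d

  -- The Fine numbers with the convention F₀ = 1 (whereas fine 0 = 0), which makes the
  -- recurrence below hold for every n ≥ 2.
  fineSeq : ℕ → ℕ
  fineSeq zero = 1
  fineSeq (suc zero) = 0
  fineSeq (suc (suc d)) = ballotSeries 1 d

  fineSeq-recurrence : ∀ d → fineSeq (2 + d) ≡ convolve fineSeq (catalan ∘ suc) d
  fineSeq-recurrence zero = refl
  fineSeq-recurrence (suc zero) = refl
  fineSeq-recurrence (suc (suc d)) = begin
    ballot 1 (2 + d) + ballotSeries 3 d
      ≡⟨ cong₂ _+_ (sym (+-identityʳ _)) (ballotSeries-2+≡convolve 1 d) ⟩
    convolve fineSeq (catalan ∘ suc) (2 + d) ∎

  C-difference-pascal : ∀ {A B} n k → A + n C suc k ≡ n C k → B + n C (2 + k) ≡ n C suc k →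
                        (A + B) + suc n C (2 + k) ≡ suc n C suc k
  C-difference-pascal {A} {B} n k eqA eqB = begin
    (A + B) + suc n C (2 + k)               ≡⟨ cong ((A + B) +_) (nCk+nC[k+1]≡[n+1]C[k+1] n (suc k)) ⟨
    (A + B) + (n C suc k + n C (2 + k))     ≡⟨ interchange A B _ _ ⟩
    (A + n C suc k) + (B + n C (2 + k))     ≡⟨ cong₂ _+_ eqA eqB ⟩
    n C k + n C suc k                       ≡⟨ nCk+nC[k+1]≡[n+1]C[k+1] n k ⟩
    suc n C suc k ∎

  C-middle : ∀ m → (m + suc m) C suc m ≡ (m + suc m) C m
  C-middle m = trans (nCk≡nC[n∸k] (m≤n+m (suc m) m)) (cong ((m + suc m) C_) (m+n∸n≡m m (suc m)))

  -- ballot h d = (2d + h) C (d + h) − (2d + h) C (d + h + 1), stated without subtraction.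
  ballot-binomial : ∀ d h {n k} → d + h ≡ k → d + k ≡ n → ballot h d + n C suc k ≡ n C k
  ballot-binomial zero h refl refl = trans (cong (1 +_) (k>n⇒nCk≡0 (n<1+n h))) (sym (nCn≡1 h))
  ballot-binomial (suc d) zero d+0≡k refl with trans (sym d+0≡k) (cong suc (+-identityʳ d))
  ... | refl = C-difference-pascal {A = 0} (d + suc d) d (C-middle d) (ballot-binomial d 1 (+-comm d 1) refl)
  ballot-binomial (suc d) (suc h) refl refl =
    C-difference-pascal (d + suc (d + suc h)) (d + suc h)
      (ballot-binomial (suc d) h (sym (+-suc d h)) (sym (+-suc d (d + suc h))))
      (ballot-binomial d (2 + h) (+-suc d (suc h)) refl)

  ballotSum : ℕ → ℕ → ℕ → ℕ
  ballotSum h d zero = 0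
  ballotSum h d (suc K) = ballot h d + ballotSum (2 + h) (d ∸ 2) K

  m∸2∸2*n≡m∸2*[1+n] : ∀ m n → m ∸ 2 ∸ 2 * n ≡ m ∸ 2 * suc n
  m∸2∸2*n≡m∸2*[1+n] m n = trans (∸-+-assoc m 2 (2 * n)) (cong (m ∸_) (sym (*-suc 2 n)))

  ballotSum-suc : ∀ K h d → ballotSum h d (suc K) ≡ ballotSum h d K + ballot (h + 2 * K) (d ∸ 2 * K)
  ballotSum-suc zero h d = trans (+-identityʳ _) (cong (λ z → ballot z d) (sym (+-identityʳ h)))
  ballotSum-suc (suc K) h d = begin
    ballot h d + ballotSum (2 + h) (d ∸ 2) (suc K)
      ≡⟨ cong (ballot h d +_) (ballotSum-suc K (2 + h) (d ∸ 2)) ⟩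
    ballot h d + (ballotSum (2 + h) (d ∸ 2) K + ballot (2 + h + 2 * K) (d ∸ 2 ∸ 2 * K))
      ≡⟨ +-assoc (ballot h d) _ _ ⟨
    ballotSum h d (suc K) + ballot (2 + h + 2 * K) (d ∸ 2 ∸ 2 * K)
      ≡⟨ cong₂ (λ a b → ballotSum h d (suc K) + ballot a b) (index h K) (m∸2∸2*n≡m∸2*[1+n] d K) ⟩
    ballotSum h d (suc K) + ballot (h + 2 * suc K) (d ∸ 2 * suc K) ∎
    where
    index : ∀ h K → 2 + h + 2 * K ≡ h + 2 * suc K
    index = solve-∀

  [2+d]/2≡1+d/2 : ∀ d → (2 + d) / 2 ≡ suc (d / 2)
  [2+d]/2≡1+d/2 d = m/n≡1+[m∸n]/n {2 + d} {2} (s≤s (s≤s z≤n))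

  ballotSeries≡ballotSum : ∀ d h → ballotSeries h d ≡ ballotSum h d (suc (d / 2))
  ballotSeries≡ballotSum zero h = sym (+-identityʳ _)
  ballotSeries≡ballotSum (suc zero) h = sym (+-identityʳ _)
  ballotSeries≡ballotSum (suc (suc d)) h = begin
    ballot h (2 + d) + ballotSeries (2 + h) d
      ≡⟨ cong (ballot h (2 + d) +_) (ballotSeries≡ballotSum d (2 + h)) ⟩
    ballot h (2 + d) + ballotSum (2 + h) d (suc (d / 2))
      ≡⟨ cong (λ K → ballot h (2 + d) + ballotSum (2 + h) d K) ([2+d]/2≡1+d/2 d) ⟨
    ballot h (2 + d) + ballotSum (2 + h) d ((2 + d) / 2) ∎

  fineTerm : ℕ → ℕ → ℕ
  fineTerm n k = ((2 * n ∸ 2 * k ∸ 1) C (n ∸ 1)) ∸ ((2 * n ∸ 2 * k ∸ 1) C n)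

  fineTerm≡ballot : ∀ d K → fineTerm (d + 2 * suc K) (suc K) ≡ ballot (1 + 2 * K) d
  fineTerm≡ballot d K = begin
    fineTerm n (suc K)                ≡⟨ cong₂ (λ a b → (a C b) ∸ (a C n)) top (cong (_∸ 1) n≡) ⟩
    (N C (d + h)) ∸ (N C n)           ≡⟨ cong (λ z → (N C (d + h)) ∸ (N C z)) n≡ ⟩
    (N C (d + h)) ∸ (N C suc (d + h)) ≡⟨ cong (_∸ (N C suc (d + h))) (ballot-binomial d h refl refl) ⟨
    (ballot h d + N C suc (d + h)) ∸ (N C suc (d + h)) ≡⟨ m+n∸n≡m (ballot h d) (N C suc (d + h)) ⟩
    ballot h d ∎
    where
    n = d + 2 * suc K
    h = 1 + 2 * K
    N = d + (d + h)
    n≡ : n ≡ suc (d + h)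
    n≡ = index d K
      where
      index : ∀ d K → d + 2 * suc K ≡ suc (d + (1 + 2 * K))
      index = solve-∀
    top : 2 * n ∸ 2 * suc K ∸ 1 ≡ N
    top = trans (cong (λ z → z ∸ 2 * suc K ∸ 1) (double d K))
            (trans (cong (_∸ 1) (m+n∸n≡m (N + 1) (2 * suc K))) (m+n∸n≡m N 1))
      where
      double : ∀ d K → 2 * (d + 2 * suc K) ≡ (d + (d + (1 + 2 * K)) + 1) + 2 * suc K
      double = solve-∀

  fineSum≡ballotSum : ∀ n K → 2 * K ≤ n → fineSum n K ≡ ballotSum 1 (n ∸ 2) K
  fineSum≡ballotSum n zero _ = refl
  fineSum≡ballotSum n (suc K) 2K≤n = begin
    fineSum n K + fineTerm n (suc K)
      ≡⟨ cong₂ _+_ (fineSum≡ballotSum n K (≤-trans (*-monoʳ-≤ 2 (n≤1+n K)) 2K≤n)) lastTerm ⟩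
    ballotSum 1 (n ∸ 2) K + ballot (1 + 2 * K) (n ∸ 2 ∸ 2 * K)
      ≡⟨ ballotSum-suc K 1 (n ∸ 2) ⟨
    ballotSum 1 (n ∸ 2) (suc K) ∎
    where
    lastTerm : fineTerm n (suc K) ≡ ballot (1 + 2 * K) (n ∸ 2 ∸ 2 * K)
    lastTerm = begin
      fineTerm n (suc K)  ≡⟨ cong (λ m → fineTerm m (suc K)) (m∸n+n≡m 2K≤n) ⟨
      fineTerm (n ∸ 2 * suc K + 2 * suc K) (suc K) ≡⟨ fineTerm≡ballot (n ∸ 2 * suc K) K ⟩
      ballot (1 + 2 * K) (n ∸ 2 * suc K) ≡⟨ cong (ballot (1 + 2 * K)) (m∸2∸2*n≡m∸2*[1+n] n K) ⟨
      ballot (1 + 2 * K) (n ∸ 2 ∸ 2 * K) ∎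

  fineSeq≡fine : ∀ d → fineSeq (2 + d) ≡ fine (2 + d)
  fineSeq≡fine d = begin
    ballotSeries 1 d                  ≡⟨ ballotSeries≡ballotSum d 1 ⟩
    ballotSum 1 d (suc (d / 2))       ≡⟨ cong (ballotSum 1 d) ([2+d]/2≡1+d/2 d) ⟨
    ballotSum 1 d ((2 + d) / 2)       ≡⟨ fineSum≡ballotSum (2 + d) ((2 + d) / 2) 2⌊n/2⌋≤n ⟨
    fine (2 + d) ∎
    where
    2⌊n/2⌋≤n : 2 * ((2 + d) / 2) ≤ 2 + d
    2⌊n/2⌋≤n = subst (_≤ 2 + d) (*-comm ((2 + d) / 2) 2) (m/n*n≤m (2 + d) 2)

open FineNumbers

private variable
  ℓ : Level
  A : Set ℓ

∈-++-∷⁻ : ∀ {x y : A} p q → y ∈ p ++ x ∷ q → y ≢ x → y ∈ p ++ q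
∈-++-∷⁻ p q y∈ y≢x with ∈-++⁻ p y∈
... | inj₁ y∈p = ∈-++⁺ˡ y∈p
... | inj₂ (here refl) = ⊥-elim (y≢x refl)
... | inj₂ (there y∈q) = ∈-++⁺ʳ p y∈q

∈-++-∷⁺ : ∀ {x y : A} p q → y ∈ p ++ q → y ∈ p ++ x ∷ q
∈-++-∷⁺ p q y∈ with ∈-++⁻ p y∈
... | inj₁ y∈p = ∈-++⁺ˡ y∈p
... | inj₂ y∈q = ∈-++⁺ʳ p (there y∈q)

length-++-∷ : ∀ (p : List A) x q → length (p ++ x ∷ q) ≡ suc (length (p ++ q))
length-++-∷ [] x q = refl
length-++-∷ (y ∷ p) x q = cong suc (length-++-∷ p x q)

Unique-⊆⇒length≤ : ∀ {xs ys : List A} → Unique xs → xs ⊆ ys → length xs ≤ length ys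
Unique-⊆⇒length≤ {xs = []} _ _ = z≤n
Unique-⊆⇒length≤ {xs = x ∷ xs} (x∉xs ∷ xs!) xs⊆ys with ∈-∃++ (xs⊆ys (here refl))
... | p , q , refl =
  subst (suc (length xs) ≤_) (sym (length-++-∷ p x q)) (s≤s (Unique-⊆⇒length≤ xs! xs⊆p++q))
  where
  xs⊆p++q : xs ⊆ p ++ q
  xs⊆p++q y∈xs = ∈-++-∷⁻ p q (xs⊆ys (there y∈xs)) (λ { refl → lookup x∉xs y∈xs refl })

Unique-++⁻ : ∀ (xs : List A) {ys} → Unique (xs ++ ys) → Unique xs × Unique ys × Disjoint xs ys
Unique-++⁻ [] ys! = [] , ys! , λ ()
Unique-++⁻ (x ∷ xs) (x∉ ∷ rest!) with Unique-++⁻ xs rest!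
... | xs! , ys! , disjoint = (All-++⁻ˡ xs x∉ ∷ xs!) , ys! , λ where
  (here refl , v∈ys) → lookup (All-++⁻ʳ xs x∉) v∈ys refl
  (there v∈xs , v∈ys) → disjoint (v∈xs , v∈ys)

Unique-++-∷⁻ : ∀ (p : List A) {x q} → Unique (p ++ x ∷ q) → Unique (p ++ q)
Unique-++-∷⁻ [] (_ ∷ q!) = q!
Unique-++-∷⁻ (y ∷ p) (y∉ ∷ rest!) =
  All-++⁺ (All-++⁻ˡ p y∉) (drop-head (All-++⁻ʳ p y∉)) ∷ Unique-++-∷⁻ p rest!
  where
  drop-head : ∀ {P : A → Set ℓ} {z zs} → All P (z ∷ zs) → All P zs
  drop-head (_ ∷ pzs) = pzs

Unique-++-∷⇒∉ : ∀ (p : List A) {x q} → Unique (p ++ x ∷ q) → x ∉ p ++ q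
Unique-++-∷⇒∉ [] (x∉q ∷ _) x∈q = lookup x∉q x∈q refl
Unique-++-∷⇒∉ (y ∷ p) (y∉ ∷ _) (here refl) = lookup y∉ (∈-++⁺ʳ p (here refl)) refl
Unique-++-∷⇒∉ (y ∷ p) (_ ∷ rest!) (there x∈) = Unique-++-∷⇒∉ p rest! x∈

module _ (_≟_ : DecidableEquality A) where

  open import Data.List.Membership.DecPropositional _≟_ using (_∈?_)

  ⊆-length≤⇒Unique : ∀ {xs ys : List A} → Unique xs → xs ⊆ ys → length ys ≤ length xs → Unique ys
  ⊆-length≤⇒Unique {ys = []} _ _ _ = []
  ⊆-length≤⇒Unique {xs} {y ∷ ys} xs! xs⊆ length≤ = ¬Any⇒All¬ ys y∉ys ∷ ys!
    where
    y∉ys : y ∉ ys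
    y∉ys y∈ys = <-irrefl refl (≤-trans length≤ (Unique-⊆⇒length≤ xs! xs⊆ys))
      where
      xs⊆ys : xs ⊆ ys
      xs⊆ys x∈ with xs⊆ x∈
      ... | here refl = y∈ys
      ... | there x∈ys = x∈ys
    ys! : Unique ys
    ys! with y ∈? xs
    ... | no y∉xs = ⊆-length≤⇒Unique xs! xs⊆ys (m+n≤o⇒n≤o 1 length≤)
      where
      xs⊆ys : xs ⊆ ys
      xs⊆ys x∈ with xs⊆ x∈
      ... | here refl = ⊥-elim (y∉xs x∈)
      ... | there x∈ys = x∈ys
    ... | yes y∈xs with ∈-∃++ y∈xs
    ...   | p , q , refl = ⊆-length≤⇒Unique (Unique-++-∷⁻ p xs!) p++q⊆ys
                             (≤-pred (subst (suc (length ys) ≤_) (length-++-∷ p y q) length≤))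
      where
      p++q⊆ys : p ++ q ⊆ ys
      p++q⊆ys x∈ with xs⊆ (∈-++-∷⁺ p q x∈)
      ... | here refl = ⊥-elim (Unique-++-∷⇒∉ p xs! x∈)
      ... | there x∈ys = x∈ys

length-cartesianProductWith : ∀ {A B C : Set} (f : A → B → C) xs ys →
                              length (cartesianProductWith f xs ys) ≡ length xs * length ys
length-cartesianProductWith f [] ys = refl
length-cartesianProductWith f (x ∷ xs) ys =
  trans (length-++ (map (f x) ys)) (cong₂ _+_ (length-map (f x) ys) (length-cartesianProductWith f xs ys))

concatMap-map≡cartesianProductWith : ∀ {A B C : Set} (f : A → B → C) xs ys →
                                     concatMap (λ x → map (f x) ys) xs ≡ cartesianProductWith f xs ys
concatMap-map≡cartesianProductWith f [] ys = refl
concatMap-map≡cartesianProductWith f (x ∷ xs) ys =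
  cong (map (f x) ys ++_) (concatMap-map≡cartesianProductWith f xs ys)

length-concatMap : ∀ {A B : Set} (f : A → List B) xs → length (concatMap f xs) ≡ sum (map (length ∘ f) xs)
length-concatMap f [] = refl
length-concatMap f (x ∷ xs) = trans (length-++ (f x)) (cong (length (f x) +_) (length-concatMap f xs))

sum-applyUpTo-mono-≤ : ∀ n {f g : ℕ → ℕ} → (∀ i → i < n → f i ≤ g i) →
                       sum (applyUpTo f n) ≤ sum (applyUpTo g n)
sum-applyUpTo-mono-≤ zero f≤g = z≤n
sum-applyUpTo-mono-≤ (suc n) f≤g =
  +-mono-≤ (f≤g 0 (s≤s z≤n)) (sum-applyUpTo-mono-≤ n (λ i i<n → f≤g (suc i) (s≤s i<n)))

Unique-applyUpTo-suc : ∀ n → Unique (applyUpTo suc n)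
Unique-applyUpTo-suc n = applyUpTo⁺₁ suc n (λ i<j _ → <⇒≢ i<j ∘ suc-injective)

InInterval : ℕ → ℕ → ℕ → Set
InInterval lo n x = lo < x × x ≤ lo + n

∈-interval : ∀ {lo n x} → InInterval lo n x → x ∈ applyUpTo (λ i → lo + suc i) n
∈-interval {lo} {n} {x} (lo<x , x≤) = subst (_∈ applyUpTo (λ i → lo + suc i) n) lo+1+i≡x (∈-applyUpTo⁺ _ i<n)
  where
  i = x ∸ suc lo
  lo+1+i≡x : lo + suc i ≡ x
  lo+1+i≡x = trans (+-suc lo i) (m+[n∸m]≡n lo<x)
  i<n : i < n
  i<n = +-cancelˡ-≤ lo (suc i) n (subst (_≤ lo + n) (sym lo+1+i≡x) x≤)

Unique-InInterval⇒length≤ : ∀ {xs} lo n → Unique xs → All (InInterval lo n) xs → length xs ≤ n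
Unique-InInterval⇒length≤ {xs} lo n xs! bounded =
  subst (length xs ≤_) (length-applyUpTo _ n) (Unique-⊆⇒length≤ xs! (∈-interval ∘ lookup bounded))

InInterval-separate : ∀ {lo a g xs ys} → Unique xs → Unique ys → length xs ≡ a → length ys ≡ g →
                      All (InInterval lo (a + g)) xs → All (InInterval lo (a + g)) ys →
                      (∀ {x y} → x ∈ xs → y ∈ ys → x < y) →
                      All (InInterval lo a) xs × All (InInterval (lo + a) g) ys
InInterval-separate {lo} {a} {g} {xs} {ys} xs! ys! refl refl xs-in ys-in xs<ys =
  tabulate (λ x∈ → proj₁ (lookup xs-in x∈) , x≤lo+a x∈) , tabulate (λ y∈ → lo+a<y y∈ , y≤top y∈)
  where
  x≤lo+a : ∀ {x} → x ∈ xs → x ≤ lo + a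
  x≤lo+a {x} x∈ = +-cancelʳ-≤ g x (lo + a) (begin
    x + g                 ≡⟨ +-comm x g ⟩
    g + x                 ≤⟨ m≤o∸n⇒m+n≤o g x≤top (Unique-InInterval⇒length≤ x (lo + (a + g) ∸ x) ys! above-x) ⟩
    lo + (a + g)          ≡⟨ +-assoc lo a g ⟨
    lo + a + g ∎)
    where
    open ≤-Reasoning
    x≤top = proj₂ (lookup xs-in x∈)
    above-x : All (InInterval x (lo + (a + g) ∸ x)) ys
    above-x = tabulate λ {y} y∈ → xs<ys x∈ y∈ , subst (y ≤_) (sym (m+[n∸m]≡n x≤top)) (proj₂ (lookup ys-in y∈))
  lo+a<y : ∀ {y} → y ∈ ys → lo + a < y
  lo+a<y {y} y∈ = subst (lo + a <_) lo+1+r≡y (s≤s (+-monoʳ-≤ lo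
                    (Unique-InInterval⇒length≤ lo (y ∸ suc lo) xs! below-y)))
    where
    lo+1+r≡y : suc lo + (y ∸ suc lo) ≡ y
    lo+1+r≡y = m+[n∸m]≡n (proj₁ (lookup ys-in y∈))
    below-y : All (InInterval lo (y ∸ suc lo)) xs
    below-y = tabulate λ x∈ → proj₁ (lookup xs-in x∈) , ≤-pred (subst (_ <_) (sym lo+1+r≡y) (xs<ys x∈ y∈))
  y≤top : ∀ {y} → y ∈ ys → y ≤ lo + a + g
  y≤top {y} y∈ = subst (y ≤_) (sym (+-assoc lo a g)) (proj₂ (lookup ys-in y∈))

any-++⁺ˡ : ∀ (p : ℕ → Bool) xs {ys} → T (any p xs) → T (any p (xs ++ ys))
any-++⁺ˡ p xs = any⁺ p ∘ Any-++⁺ˡ ∘ any⁻ p xs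

has21-++⁺ˡ : ∀ a xs {ys} → T (has21 a xs) → T (has21 a (xs ++ ys))
has21-++⁺ˡ a (y ∷ xs) {ys} h =
  from (T-∨ {(a <ᵇ y) ∧ any (_<ᵇ a) (xs ++ ys)}) (⊎-map extend (has21-++⁺ˡ a xs) (to T-∨ h))
  where
  extend : T ((a <ᵇ y) ∧ any (_<ᵇ a) xs) → T ((a <ᵇ y) ∧ any (_<ᵇ a) (xs ++ ys))
  extend t with to T-∧ t
  ... | a<y , below = from T-∧ (a<y , any-++⁺ˡ (_<ᵇ a) xs below)

contains231-++⁺ˡ : ∀ xs {ys} → T (contains231 xs) → T (contains231 (xs ++ ys))
contains231-++⁺ˡ (x ∷ xs) {ys} h =
  from (T-∨ {has21 x (xs ++ ys)}) (⊎-map (has21-++⁺ˡ x xs) (contains231-++⁺ˡ xs) (to T-∨ h))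

contains231-++⁺ʳ : ∀ xs {ys} → T (contains231 ys) → T (contains231 (xs ++ ys))
contains231-++⁺ʳ [] h = h
contains231-++⁺ʳ (x ∷ xs) {ys} h = from (T-∨ {has21 x (xs ++ ys)}) (inj₂ (contains231-++⁺ʳ xs h))

has21-pattern : ∀ {a y z} q r → a < y → z ∈ r → z < a → T (has21 a (q ++ y ∷ r))
has21-pattern {a} {y} [] r a<y z∈r z<a =
  from (T-∨ {(a <ᵇ y) ∧ any (_<ᵇ a) r}) (inj₁ (from T-∧ (<⇒<ᵇ a<y , any⁺ (_<ᵇ a) (lose z∈r (<⇒<ᵇ z<a)))))
has21-pattern {a} (q₀ ∷ q) r a<y z∈r z<a =
  from (T-∨ {(a <ᵇ q₀) ∧ any (_<ᵇ a) (q ++ _ ∷ r)}) (inj₂ (has21-pattern q r a<y z∈r z<a))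

contains231-pattern : ∀ {x y M} xs ys → x ∈ xs → y ∈ ys → y < x → x < M → T (contains231 (xs ++ M ∷ ys))
contains231-pattern {x} {y} {M} xs ys x∈ y∈ y<x x<M with ∈-∃++ x∈
... | p , q , refl = subst (T ∘ contains231) (sym (++-assoc p (x ∷ q) (M ∷ ys)))
                       (contains231-++⁺ʳ p (from (T-∨ {has21 x (q ++ M ∷ ys)}) (inj₁ (has21-pattern q ys x<M y∈ y<x))))

avoids231⇒before<after : ∀ {M} α γ → ¬ T (contains231 (α ++ M ∷ γ)) → All (_< M) α → Disjoint α γ →
                         ∀ {x y} → x ∈ α → y ∈ γ → x < y
avoids231⇒before<after α γ avoids α<M α∩γ=∅ {x} {y} x∈ y∈ with <-cmp x y
... | tri< x<y _ _ = x<y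
... | tri≈ _ refl _ = ⊥-elim (α∩γ=∅ (x∈ , y∈))
... | tri> _ _ y<x = ⊥-elim (avoids (contains231-pattern α γ x∈ y∈ y<x (lookup α<M x∈)))

noFixAux-++⁻ : ∀ i xs {ys} → T (noFixAux i (xs ++ ys)) → T (noFixAux i xs) × T (noFixAux (i + length xs) ys)
noFixAux-++⁻ i [] {ys} ok = _ , subst (λ j → T (noFixAux j ys)) (sym (+-identityʳ i)) ok
noFixAux-++⁻ i (x ∷ xs) {ys} ok with to (T-∧ {not (x ≡ᵇ i)}) ok
... | x≢i , rest with noFixAux-++⁻ (suc i) xs rest
... | xs-ok , ys-ok = from T-∧ (x≢i , xs-ok) , subst (λ j → T (noFixAux j ys)) (sym (+-suc i (length xs))) ys-ok

headIsNot : ℕ → List ℕ → Bool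
headIsNot v [] = true
headIsNot v (x ∷ _) = not (x ≡ᵇ v)

noFixAux⇒headIsNot : ∀ i xs → T (noFixAux i xs) → T (headIsNot i xs)
noFixAux⇒headIsNot i [] _ = _
noFixAux⇒headIsNot i (x ∷ xs) ok = proj₁ (to (T-∧ {not (x ≡ᵇ i)}) ok)

record IntervalPerm (lo m : ℕ) (w : List ℕ) : Set where
  field
    unique  : Unique w
    length≡ : length w ≡ m
    bounded : All (InInterval lo m) w

record MaxSplit (lo k : ℕ) (w : List ℕ) : Set where
  field
    left right  : List ℕ
    w≡          : w ≡ left ++ (lo + suc k) ∷ right
    left≤       : length left ≤ k
    left-perm   : IntervalPerm lo (length left) left
    right-perm  : IntervalPerm (lo + length left) (k ∸ length left) right
    left-avoids : ¬ T (contains231 left)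
    right-avoids : ¬ T (contains231 right)

IntervalPerm-max∈ : ∀ {lo k w} → IntervalPerm lo (suc k) w → lo + suc k ∈ w
IntervalPerm-max∈ {lo} {k} {w} perm with any? (lo + suc k ≟_) w
... | yes max∈ = max∈
... | no max∉ = ⊥-elim (1+n≰n (subst (_≤ k) length≡ (Unique-InInterval⇒length≤ lo k unique below-max)))
  where
  open IntervalPerm perm
  below-max : All (InInterval lo k) w
  below-max = tabulate λ {x} x∈ → proj₁ (lookup bounded x∈) ,
    ≤-pred (subst (x <_) (+-suc lo k) (≤∧≢⇒< (proj₂ (lookup bounded x∈)) λ { refl → max∉ x∈ }))

split-at-max : ∀ {lo k w} → IntervalPerm lo (suc k) w → ¬ T (contains231 w) → MaxSplit lo k w
split-at-max {lo} {k} perm avoids with ∈-∃++ (IntervalPerm-max∈ perm)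
... | α , γ , refl with Unique-++⁻ α (IntervalPerm.unique perm)
... | α! , M∉γ ∷ γ! , α∩Mγ=∅ = record
  { left = α ; right = γ ; w≡ = refl ; left≤ = a≤k
  ; left-perm = record { unique = α! ; length≡ = refl ; bounded = proj₁ separated }
  ; right-perm = record { unique = γ! ; length≡ = g≡k∸a
                        ; bounded = subst (λ m → All (InInterval (lo + a) m) γ) g≡k∸a (proj₂ separated) }
  ; left-avoids = avoids ∘ contains231-++⁺ˡ α
  ; right-avoids = avoids ∘ contains231-++⁺ʳ α ∘ from (T-∨ {has21 M γ}) ∘ inj₂
  }
  where
  open IntervalPerm perm
  M = lo + suc k
  a = length α
  g = length γ
  a+g≡k : a + g ≡ k
  a+g≡k = suc-injective (trans (sym (+-suc a g)) (trans (sym (length-++ α)) length≡))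
  a≤k : a ≤ k
  a≤k = subst (a ≤_) a+g≡k (m≤m+n a g)
  g≡k∸a : g ≡ k ∸ a
  g≡k∸a = trans (sym (m+n∸m≡n a g)) (cong (_∸ a) a+g≡k)
  below-max : ∀ {x} → x ∈ α ++ M ∷ γ → x ≢ M → InInterval lo (a + g) x
  below-max {x} x∈ x≢M with lookup bounded x∈
  ... | lo<x , x≤M =
    lo<x , subst (λ m → x ≤ lo + m) (sym a+g≡k) (≤-pred (subst (x <_) (+-suc lo k) (≤∧≢⇒< x≤M x≢M)))
  α-below : All (InInterval lo (a + g)) α
  α-below = tabulate λ x∈ → below-max (∈-++⁺ˡ x∈) λ { refl → α∩Mγ=∅ (x∈ , here refl) }
  γ-below : All (InInterval lo (a + g)) γ
  γ-below = tabulate λ y∈ → below-max (∈-++⁺ʳ α (there y∈)) λ { refl → lookup M∉γ y∈ refl }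
  α<M : All (_< M) α
  α<M = tabulate λ {x} x∈ → subst (suc x ≤_) (sym (+-suc lo k))
          (s≤s (subst (λ m → x ≤ lo + m) a+g≡k (proj₂ (lookup α-below x∈))))
  separated = InInterval-separate α! γ! refl refl α-below γ-below
                (avoids231⇒before<after α γ avoids α<M λ (x∈ , y∈) → α∩Mγ=∅ (x∈ , there y∈))

assemble : ℕ → ℕ → (ℕ → List (List ℕ)) → (ℕ → List (List ℕ)) → List (List ℕ)
assemble M n lefts rights = concatMap (λ a → cartesianProductWith (λ α γ → α ++ M ∷ γ) (lefts a) (rights a)) (upTo n)

∈-assemble⁺ : ∀ {M n lefts rights a α γ} → a < n → α ∈ lefts a → γ ∈ rights a →
              α ++ M ∷ γ ∈ assemble M n lefts rights
∈-assemble⁺ a<n α∈ γ∈ = ∈-concatMap⁺ _ (lose (∈-upTo⁺ a<n) (∈-cartesianProductWith⁺ _ α∈ γ∈))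

length-assemble : ∀ M n lefts rights →
                  length (assemble M n lefts rights) ≡
                  sum (applyUpTo (λ a → length (lefts a) * length (rights a)) n)
length-assemble M n lefts rights = begin
  length (assemble M n lefts rights)     ≡⟨ length-concatMap prods (upTo n) ⟩
  sum (map (length ∘ prods) (upTo n))    ≡⟨ cong sum (map-upTo (length ∘ prods) n) ⟩
  sum (applyUpTo (length ∘ prods) n)
    ≡⟨ cong sum (applyUpTo-cong n (λ a → length-cartesianProductWith _ (lefts a) (rights a))) ⟩
  sum (applyUpTo (λ a → length (lefts a) * length (rights a)) n) ∎
  where
  open ≡-Reasoning
  prods = λ a → cartesianProductWith (λ α γ → α ++ M ∷ γ) (lefts a) (rights a)
  applyUpTo-cong : ∀ n {f g : ℕ → ℕ} → (∀ i → f i ≡ g i) → applyUpTo f n ≡ applyUpTo g n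
  applyUpTo-cong zero _ = refl
  applyUpTo-cong (suc n) f≡g = cong₂ _∷_ (f≡g 0) (applyUpTo-cong n (f≡g ∘ suc))

-- f is fuel: f > m suffices to contain every 231-avoiding arrangement of (lo, lo + m].
avoiders : ℕ → ℕ → ℕ → List (List ℕ)
avoiders zero lo m = []
avoiders (suc f) lo zero = [] ∷ []
avoiders (suc f) lo (suc k) = assemble (lo + suc k) (suc k) (avoiders f lo) (λ a → avoiders f (lo + a) (k ∸ a))

∈-avoiders-suc⁺ : ∀ {f lo k a α γ} → a ≤ k → α ∈ avoiders f lo a → γ ∈ avoiders f (lo + a) (k ∸ a) →
                  α ++ (lo + suc k) ∷ γ ∈ avoiders (suc f) lo (suc k)
∈-avoiders-suc⁺ {f} {lo} {k} a≤k =
  ∈-assemble⁺ {lo + suc k} {suc k} {avoiders f lo} {λ a → avoiders f (lo + a) (k ∸ a)} (s≤s a≤k)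

∈-avoiders : ∀ {f lo m w} → m < f → IntervalPerm lo m w → ¬ T (contains231 w) → w ∈ avoiders f lo m
∈-avoiders {suc f} {m = zero} {[]} _ _ _ = here refl
∈-avoiders {suc f} {m = zero} {_ ∷ _} _ record { length≡ = () } _
∈-avoiders {suc f} {m = suc k} (s≤s k<f) perm avoids with split-at-max perm avoids
... | record { left = α ; w≡ = refl ; left≤ = a≤k ; left-perm = left-perm ; right-perm = right-perm
             ; left-avoids = left-avoids ; right-avoids = right-avoids } =
  ∈-avoiders-suc⁺ {f} a≤k (∈-avoiders (≤-<-trans a≤k k<f) left-perm left-avoids)
                          (∈-avoiders (≤-<-trans (m∸n≤m k (length α)) k<f) right-perm right-avoids)

length-avoiders : ∀ f lo m → length (avoiders f lo m) ≤ catalan m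
length-avoiders zero lo m = z≤n
length-avoiders (suc f) lo zero = ≤-refl
length-avoiders (suc f) lo (suc k) = begin
  length (avoiders (suc f) lo (suc k))
    ≡⟨ length-assemble (lo + suc k) (suc k) (avoiders f lo) (λ a → avoiders f (lo + a) (k ∸ a)) ⟩
  sum (applyUpTo (λ a → length (avoiders f lo a) * length (avoiders f (lo + a) (k ∸ a))) (suc k))
    ≤⟨ sum-applyUpTo-mono-≤ (suc k) (λ a _ →
         *-mono-≤ (length-avoiders f lo a) (length-avoiders f (lo + a) (k ∸ a))) ⟩
  convolve catalan catalan k
    ≡⟨ ballot-suc≡convolve k 0 ⟨
  catalan (suc k) ∎
  where open ≤-Reasoning

-- The possible parts γ of a derangement α ++ n ∷ γ with length α = a: γ starts at position a + 2.
tailAvoiders : ℕ → ℕ → List (List ℕ)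
tailAvoiders a m = filter (λ γ → T? (headIsNot (2 + a) γ)) (avoiders (suc m) a m)

length-tailAvoiders : ∀ a m → length (tailAvoiders a m) ≤ catalan m
length-tailAvoiders a m = ≤-trans (length-filter _ (avoiders (suc m) a m)) (length-avoiders (suc m) a m)

transposition12 : ℕ → List ℕ
transposition12 j = 2 ∷ 1 ∷ applyUpTo (3 +_) j

transposition12∈avoiders : ∀ j → transposition12 j ∈ avoiders (3 + j) 0 (2 + j)
transposition12∈avoiders zero =
  ∈-avoiders-suc⁺ {f = 2} {lo = 0} {k = 1} {a = 0} z≤n (here refl)
    (∈-avoiders-suc⁺ {f = 1} {lo = 0} {k = 0} {a = 0} z≤n (here refl) (here refl))
transposition12∈avoiders (suc j) =
  subst (_∈ avoiders (4 + j) 0 (3 + j)) (cong (λ t → 2 ∷ 1 ∷ t) (applyUpTo-∷ʳ (3 +_) j))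
    (∈-avoiders-suc⁺ {a = 2 + j} ≤-refl (transposition12∈avoiders j)
      (subst (λ m → [] ∈ avoiders (3 + j) (2 + j) m) (sym (n∸n≡0 (2 + j))) (here refl)))

length-tailAvoiders-0< : ∀ j → length (tailAvoiders 0 (2 + j)) < catalan (2 + j)
length-tailAvoiders-0< j = <-≤-trans
  (filter-notAll _ (avoiders (3 + j) 0 (2 + j)) (lose (transposition12∈avoiders j) (λ ())))
  (length-avoiders (3 + j) 0 (2 + j))

length-tailAvoiders≤ : ∀ e a → a ≤ e → length (tailAvoiders a (suc e ∸ a)) ≤ catalan (suc (e ∸ a))
length-tailAvoiders≤ e a a≤e =
  subst (λ m → length (tailAvoiders a (suc e ∸ a)) ≤ catalan m) (+-∸-assoc 1 a≤e) (length-tailAvoiders a (suc e ∸ a))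

derangedAvoiders : ℕ → ℕ → List (List ℕ)
derangedAvoiders f zero = [] ∷ []
derangedAvoiders f (suc zero) = []
derangedAvoiders zero (suc (suc e)) = []
derangedAvoiders (suc f) (suc (suc e)) = assemble (2 + e) (suc e) (derangedAvoiders f) (λ a → tailAvoiders a (suc e ∸ a))

∈-derangedAvoiders-suc⁺ : ∀ {f e a α γ} → a ≤ e → α ∈ derangedAvoiders f a → γ ∈ tailAvoiders a (suc e ∸ a) →
                          α ++ (2 + e) ∷ γ ∈ derangedAvoiders (suc f) (2 + e)
∈-derangedAvoiders-suc⁺ {f} {e} a≤e =
  ∈-assemble⁺ {2 + e} {suc e} {derangedAvoiders f} {λ a → tailAvoiders a (suc e ∸ a)} (s≤s a≤e)

∈-derangedAvoiders : ∀ {f n w} → n ≤ f → IntervalPerm 0 n w → T (noFix w) → ¬ T (contains231 w) →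
                     w ∈ derangedAvoiders f n
∈-derangedAvoiders {n = zero} {[]} _ _ _ _ = here refl
∈-derangedAvoiders {n = zero} {_ ∷ _} _ record { length≡ = () } _ _
∈-derangedAvoiders {n = suc zero} {[]} _ record { length≡ = () } _ _
∈-derangedAvoiders {n = suc zero} {x ∷ _ ∷ _} _ record { length≡ = () } _ _
∈-derangedAvoiders {n = suc zero} {zero ∷ []} _ record { bounded = (() , _) ∷ [] } _ _
∈-derangedAvoiders {n = suc zero} {suc zero ∷ []} _ _ () _
∈-derangedAvoiders {n = suc zero} {suc (suc x) ∷ []} _ record { bounded = (_ , s≤s ()) ∷ [] } _ _
∈-derangedAvoiders {suc f} {suc (suc e)} (s≤s n≤f) perm nofix avoids with split-at-max perm avoids
... | record { left = α ; right = γ ; w≡ = refl ; left≤ = a≤1+e ; left-perm = left-perm ; right-perm = right-perm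
             ; left-avoids = left-avoids ; right-avoids = right-avoids }
    with noFixAux-++⁻ 1 α nofix
... | left-nofix , rest-nofix with to (T-∧ {not ((2 + e) ≡ᵇ suc (length α))}) rest-nofix
... | max≢1+a , right-nofix =
  ∈-derangedAvoiders-suc⁺ a≤e
    (∈-derangedAvoiders (≤-trans a≤e (≤-trans (n≤1+n e) n≤f)) left-perm left-nofix left-avoids)
    (∈-filter⁺ _ (∈-avoiders ≤-refl right-perm right-avoids) (noFixAux⇒headIsNot (2 + length α) γ right-nofix))
  where
  a≤e : length α ≤ e
  a≤e = ≤-pred (≤∧≢⇒< a≤1+e λ a≡1+e →
          subst T (to T-not-≡ max≢1+a) (≡⇒≡ᵇ (2 + e) (suc (length α)) (cong suc (sym a≡1+e))))

length-derangedAvoiders : ∀ f n → length (derangedAvoiders f n) ≤ fineSeq n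
length-derangedAvoiders f zero = ≤-refl
length-derangedAvoiders f (suc zero) = z≤n
length-derangedAvoiders zero (suc (suc e)) = z≤n
length-derangedAvoiders (suc f) (suc (suc e)) = begin
  length (derangedAvoiders (suc f) (2 + e))
    ≡⟨ length-assemble (2 + e) (suc e) (derangedAvoiders f) (λ a → tailAvoiders a (suc e ∸ a)) ⟩
  sum (applyUpTo (λ a → length (derangedAvoiders f a) * length (tailAvoiders a (suc e ∸ a))) (suc e))
    ≤⟨ sum-applyUpTo-mono-≤ (suc e) (λ a a<1+e →
         *-mono-≤ (length-derangedAvoiders f a) (length-tailAvoiders≤ e a (≤-pred a<1+e))) ⟩
  convolve fineSeq (catalan ∘ suc) e
    ≡⟨ fineSeq-recurrence e ⟨
  fineSeq (2 + e) ∎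
  where open ≤-Reasoning

-- Strict because the summand a = 0 loses transposition12.
length-derangedAvoiders< : ∀ f j → length (derangedAvoiders (suc f) (3 + j)) < fineSeq (3 + j)
length-derangedAvoiders< f j = begin-strict
  length (derangedAvoiders (suc f) (3 + j))
    ≡⟨ length-assemble (3 + j) (2 + j) (derangedAvoiders f) (λ a → tailAvoiders a (2 + j ∸ a)) ⟩
  1 * length (tailAvoiders 0 (2 + j))
    + sum (applyUpTo (λ a → length (derangedAvoiders f (suc a)) * length (tailAvoiders (suc a) (suc j ∸ a))) (suc j))
    <⟨ +-mono-<-≤ (*-monoʳ-< 1 (length-tailAvoiders-0< j)) (sum-applyUpTo-mono-≤ (suc j) (λ a a<1+j →
         *-mono-≤ (length-derangedAvoiders f (suc a)) (length-tailAvoiders≤ (suc j) (suc a) a<1+j))) ⟩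
  convolve fineSeq (catalan ∘ suc) (suc j)
    ≡⟨ fineSeq-recurrence (suc j) ⟨
  fineSeq (3 + j) ∎
  where open ≤-Reasoning

Unique-words : ∀ m k → Unique (words m k)
Unique-words m zero = [] ∷ []
Unique-words m (suc k) = subst Unique (sym (concatMap-map≡cartesianProductWith _∷_ (applyUpTo suc m) (words m k)))
  (cartesianProductWith⁺ _∷_ ∷-injective (Unique-applyUpTo-suc m) (Unique-words m k))

∈-words⁻ : ∀ {m} k {w} → w ∈ words m k → length w ≡ k × All (InInterval 0 m) w
∈-words⁻ zero (here refl) = refl , []
∈-words⁻ {m} (suc k) w∈
  with ∈-cartesianProductWith⁻ _∷_ (applyUpTo suc m) (words m k)
         (subst (_ ∈_) (concatMap-map≡cartesianProductWith _∷_ (applyUpTo suc m) (words m k)) w∈)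
... | x , w′ , x∈ , w′∈ , refl with ∈-applyUpTo⁻ suc x∈ | ∈-words⁻ k w′∈
...   | i , i<m , refl | length≡ , bounded = cong suc length≡ , (s≤s z≤n , i<m) ∷ bounded

∈-perms⇒IntervalPerm : ∀ {n w} → w ∈ perms n → IntervalPerm 0 n w
∈-perms⇒IntervalPerm {n} {w} w∈ with ∈-filter⁻ (λ w → T? (isPerm n w)) w∈
... | w∈words , covers with ∈-words⁻ n w∈words
... | length≡ , bounded = record
  { unique = ⊆-length≤⇒Unique _≟_ (Unique-applyUpTo-suc n) values⊆w
               (≤-reflexive (trans length≡ (sym (length-applyUpTo suc n))))
  ; length≡ = length≡
  ; bounded = bounded
  }
  where
  values⊆w : applyUpTo suc n ⊆ w
  values⊆w v∈ = Any-map (λ {x} t → sym (≡ᵇ⇒≡ x _ t)) (any⁻ _ w (lookup (all⁺ _ (applyUpTo suc n) covers) v∈))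

d231≤length-derangedAvoiders : ∀ n → d231 n ≤ length (derangedAvoiders n n)
d231≤length-derangedAvoiders n =
  Unique-⊆⇒length≤ (filter⁺ _ (filter⁺ _ (Unique-words n n))) counted⊆
  where
  counted⊆ : filter (λ w → T? (noFix w ∧ avoids231 w)) (perms n) ⊆ derangedAvoiders n n
  counted⊆ {w} w∈ with ∈-filter⁻ (λ w → T? (noFix w ∧ avoids231 w)) {xs = perms n} w∈
  ... | w∈perms , ok with to (T-∧ {noFix w}) ok
  ... | nofix , avoids =
    ∈-derangedAvoiders {n} ≤-refl (∈-perms⇒IntervalPerm w∈perms) nofix (subst T (to T-not-≡ avoids))

theorem7p1 : (n : ℕ) → 3 ≤ n → d231 n < fine n
theorem7p1 (suc (suc zero)) (s≤s (s≤s ()))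
theorem7p1 (suc (suc (suc j))) _ = begin-strict
  d231 (3 + j)                               ≤⟨ d231≤length-derangedAvoiders (3 + j) ⟩
  length (derangedAvoiders (3 + j) (3 + j))  <⟨ length-derangedAvoiders< (2 + j) j ⟩
  fineSeq (3 + j)                            ≡⟨ fineSeq≡fine (suc j) ⟩
  fine (3 + j) ∎
  where open ≤-Reasoning
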